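{- Let $\rho: l\to r\Leftarrow s_1\twoheadrightarrow t_1;\dots;s_k\twoheadrightarrow t_k$ be an extended deterministic conditional rewrite rule, and for $1\le i\le k$ let $X_i=\mathrm{Var}(l,t_1,\dots,t_{i-1})$. Then: (1) $\rho$ is $\mathbb{U}$-LL iff all of $l,t_1,\dots,t_k$ are linear and $\mathrm{Var}(t_i)\cap X_i=\emptyset$ for all $1\le i\le k$; (2) $\rho$ is $\mathbb{U}$-RL iff $r$ is linear and all of $s_1,\dots,s_k$ are ground; (3) $\rho$ is $\mathbb{U}$-NE iff $\mathrm{Var}(l,t_1,\dots,t_k)\subseteq\mathrm{Var}(r)$.
   Context: $\mathrm{Var}(t_1,\dots,t_n)$ is the set of variables occurring in the terms; a term is linear if no variable occurs twice, ground if it has no variables. An extended conditional rewrite rule $l\to r\Leftarrow s_1\twoheadrightarrow t_1;\dots;s_k\twoheadrightarrow t_k$ ($k\ge0$; $l$ may be a variable) is deterministic if $\mathrm{Var}(s_i)\subseteq\mathrm{Var}(l,t_1,\dots,t_{i-1})$ for all $i$. An unconditional rule $l\to r$ is LL if $l$ is linear, RL if $r$ is linear, NE if $\mathrm{Var}(l)\subseteq\mathrm{Var}(r)$. Ohlebusch's unraveling of $\rho$ with $k\ge1$: with $\overrightarrow{X}$ the list of the elements of a finite variable set $X$ in a fixed order (without repetition) and fresh function symbols $U^\rho_1,\dots,U^\rho_k$: $\mathbb{U}(\rho)=\{l\to U^\rho_1(s_1,\overrightarrow{X_1})\}\cup\{U^\rho_i(t_i,\overrightarrow{X_i})\to U^\rho_{i+1}(s_{i+1},\overrightarrow{X_{i+1}})\mid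 1\le i<k\}\cup\{U^\rho_k(t_k,\overrightarrow{X_k})\to r\}$; for $k=0$, $\mathbb{U}(\rho)=\{l\to r\}$. For a property P of unconditional rules, $\rho$ is $\mathbb{U}$-P if every rule in $\mathbb{U}(\rho)$ has P. -}

module Defs where

open import Data.Nat using (ℕ; zero; suc)
open import Data.Fin using (Fin; toℕ)
open import Data.List using (List; []; _∷_; _++_; map; concatMap; take; length; lookup; deduplicate)
open import Data.List.Relation.Unary.All using (All)
open import Data.List.Relation.Unary.Unique.Propositional using (Unique)
open import Data.List.Relation.Binary.Subset.Propositional using (_⊆_)
open import Data.List.Membership.Propositional using (_∈_; _∉_)
open import Data.Product using (_×_; _,_; proj₁; proj₂)
open import Data.Sum using (_⊎_; inj₁; inj₂)
open import Relation.Binary.Definitions using (DecidableEquality)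
open import Relation.Binary.PropositionalEquality using (_≡_)

data Term (F V : Set) : Set where
  var : V → Term F V
  app : F → List (Term F V) → Term F V

module _ {F V : Set} where
  -- list of variable occurrences (with multiplicity, left-to-right)
  vars : Term F V → List V
  varsL : List (Term F V) → List V
  vars (var x) = x ∷ []
  vars (app f ts) = varsL ts
  varsL [] = []
  varsL (t ∷ ts) = vars t ++ varsL ts

  Linear : Term F V → Set
  Linear t = Unique (vars t)

  Ground : Term F V → Set
  Ground t = vars t ≡ []

Rule : Set → Set → Set
Rule F V = Term F V × Term F V

module _ {F V : Set} where
  LL : Rule F V → Set
  LL (l , r) = Linear l

  RL : Rule F V → Set
  RL (l , r) = Linear r

  NE : Rule F V → Set
  NE (l , r) = vars l ⊆ vars r

record CRule (F V : Set) : Set where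
  constructor _⇒_⇐_
  field
    lhs   : Term F V
    rhs   : Term F V
    conds : List (Term F V × Term F V)
open CRule public

module _ {F V : Set} (ρ : CRule F V) where
  #conds : ℕ
  #conds = length (conds ρ)

  -- s_{i+1}, t_{i+1} for 0-based index i
  sᵢ tᵢ : Fin #conds → Term F V
  sᵢ i = proj₁ (lookup (conds ρ) i)
  tᵢ i = proj₂ (lookup (conds ρ) i)

  varsUpTo : ℕ → List V
  varsUpTo j = vars (lhs ρ) ++ concatMap (λ c → vars (proj₂ c)) (take j (conds ρ))

  -- X_{i+1} = Var(l, t₁, …, t_i)  for 0-based index i
  Xᵢ : Fin #conds → List V
  Xᵢ i = varsUpTo (toℕ i)

  allLT : List V
  allLT = varsUpTo #conds

  Deterministic : Set
  Deterministic = (i : Fin #conds) → vars (sᵢ i) ⊆ Xᵢ i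

-- Embedding of original terms into the signature extended by fresh symbols U_i (inj₂ i).
module _ {F V : Set} where
  emb : Term F V → Term (F ⊎ ℕ) V
  embL : List (Term F V) → List (Term (F ⊎ ℕ) V)
  emb (var x) = var x
  emb (app f ts) = app (inj₁ f) (embL ts)
  embL [] = []
  embL (t ∷ ts) = emb t ∷ embL ts

-- Ohlebusch's unraveling.  X is the occurrence list of the current variable set,
-- its ordered repetition-free listing is  deduplicate _≟_ X.
module Unravel {F V : Set} (_≟_ : DecidableEquality V) where
  vec : List V → List (Term (F ⊎ ℕ) V)
  vec X = map var (deduplicate _≟_ X)

  go : List V → ℕ → Term (F ⊎ ℕ) V → List (Term F V × Term F V) → Term F V
     → List (Rule (F ⊎ ℕ) V)
  go X i cur [] r = (cur , emb r) ∷ []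
  go X i cur ((s , t) ∷ cs) r =
    (cur , app (inj₂ i) (emb s ∷ vec X))
    ∷ go (X ++ vars t) (suc i) (app (inj₂ i) (emb t ∷ vec X)) cs r

  𝕌 : CRule F V → List (Rule (F ⊎ ℕ) V)
  𝕌 ρ = go (vars (lhs ρ)) 1 (emb (lhs ρ)) (conds ρ) (rhs ρ)

  𝕌-LL 𝕌-RL 𝕌-NE : CRule F V → Set
  𝕌-LL ρ = All LL (𝕌 ρ)
  𝕌-RL ρ = All RL (𝕌 ρ)
  𝕌-NE ρ = All NE (𝕌 ρ)

-- The unraveling of  l → r ⇐ s₁ ↠ t₁; …; sₖ ↠ tₖ  is the chain of rules
--   l → U₁(s₁, X₁),  Uᵢ(tᵢ, Xᵢ) → Uᵢ₊₁(sᵢ₊₁, Xᵢ₊₁),  Uₖ(tₖ, Xₖ) → r,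
-- where Xᵢ is listed without repetitions.  Hence every property of the
-- unraveled rules reduces to the variable list of a "call"  Uₙ(t, X),
-- which is  Var(t) followed by the deduplicated X  (lemma vars-call):
--   * Uₙ(t, X) is linear  iff  t is linear and Var(t) ∩ X = ∅   (Linear-call);
--   * if Var(s) ⊆ X, then Uₙ(s, X) is linear  iff  s is ground  (Linear-call-ground);
--   * as a set, Var(Uₙ(t, X)) = X ∪ Var(t)                       (∈-vars-call).

module Submission where

open import Defs
open import Data.Nat using (ℕ; zero; suc)
open import Data.Nat.Properties using (≤-refl)
open import Data.List using (List; []; _∷_; _++_; map; concatMap; take; length; lookup; deduplicate)
open import Data.List.Properties using (++-assoc; ++-identityʳ; take-all)
open import Data.List.Relation.Unary.All using (All; []; _∷_)
import Data.List.Relation.Unary.All as All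
import Data.List.Relation.Unary.All.Properties as AllP
open import Data.List.Relation.Unary.AllPairs using ([]; _∷_)
open import Data.List.Relation.Unary.Any using (here; there)
open import Data.List.Relation.Unary.Unique.Propositional using (Unique)
open import Data.List.Relation.Unary.Unique.Propositional.Properties using (++⁺)
open import Data.List.Relation.Unary.Unique.DecPropositional.Properties using (deduplicate-!)
open import Data.List.Relation.Binary.Subset.Propositional using (_⊆_)
open import Data.List.Relation.Binary.Disjoint.Propositional using (Disjoint)
open import Data.List.Membership.Propositional using (_∈_; _∉_)
open import Data.List.Membership.Propositional.Properties
  using (∈-++⁺ˡ; ∈-++⁺ʳ; ∈-++⁻; ∈-deduplicate⁺; ∈-deduplicate⁻)
open import Data.Fin using (Fin; toℕ; zero; suc)
open import Data.Fin.Properties using (∀-cons)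
open import Data.Product using (_×_; _,_; proj₁; proj₂)
open import Data.Sum using (_⊎_; inj₁; inj₂)
open import Function using (_∘_)
open import Function.Bundles using (_⇔_; mk⇔; Equivalence)
open import Relation.Binary.Definitions using (DecidableEquality)
open import Relation.Binary.PropositionalEquality using (_≡_; refl; subst; sym; cong)

open Equivalence using (to; from)

module _ {A : Set} where

  Unique-++⁻ : (xs : List A) {ys : List A} → Unique (xs ++ ys) →
               Unique xs × Unique ys × Disjoint xs ys
  Unique-++⁻ []       u = [] , u , λ ()
  Unique-++⁻ (x ∷ xs) (x∉rest ∷ u) with Unique-++⁻ xs u
  ... | uxs , uys , xs#ys = (AllP.++⁻ˡ xs x∉rest ∷ uxs) , uys , x∷xs#ys
    where
    x∷xs#ys : Disjoint (x ∷ xs) _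
    x∷xs#ys (here refl , x∈ys) = All.lookup x∉rest (∈-++⁺ʳ xs x∈ys) refl
    x∷xs#ys (there v∈xs , v∈ys) = xs#ys (v∈xs , v∈ys)

  disjoint-subset⇒[] : {xs ys : List A} → xs ⊆ ys → Disjoint xs ys → xs ≡ []
  disjoint-subset⇒[] {[]}    _      _     = refl
  disjoint-subset⇒[] {x ∷ _} xs⊆ys xs#ys with () ← xs#ys (here refl , xs⊆ys (here refl))

module _ {F V : Set} where

  vars-emb : (t : Term F V) → vars (emb t) ≡ vars t
  varsL-embL : (ts : List (Term F V)) → varsL (embL ts) ≡ varsL ts
  vars-emb (var x)    = refl
  vars-emb (app f ts) = varsL-embL ts
  varsL-embL []       = refl
  varsL-embL (t ∷ ts) rewrite vars-emb t | varsL-embL ts = refl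

  Linear-emb : (t : Term F V) → Linear (emb t) ⇔ Linear t
  Linear-emb t = mk⇔ (subst Unique (vars-emb t)) (subst Unique (sym (vars-emb t)))

  varsL-map-var : (xs : List V) → varsL {F ⊎ ℕ} (map var xs) ≡ xs
  varsL-map-var []       = refl
  varsL-map-var (x ∷ xs) = cong (x ∷_) (varsL-map-var xs)

  condVars : List (Term F V × Term F V) → List V
  condVars = concatMap (vars ∘ proj₂)

  -- Var(X, t₁, …, tⱼ): the accumulated variables before the (j+1)-st condition;
  -- for X = Var(l) this is exactly the list  Xᵢ  of the statement.
  before : List V → List (Term F V × Term F V) → ℕ → List V
  before X cs j = X ++ condVars (take j cs)

  before-zero : ∀ X cs → before X cs 0 ≡ X
  before-zero X cs = ++-identityʳ X

  before-suc : ∀ X s t cs j → before (X ++ vars t) cs j ≡ before X ((s , t) ∷ cs) (suc j)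
  before-suc X s t cs j = ++-assoc X (vars t) (condVars (take j cs))

module Calls {F V : Set} (_≟_ : DecidableEquality V) where
  open Unravel {F} {V} _≟_

  call : ℕ → Term F V → List V → Term (F ⊎ ℕ) V
  call n t X = app (inj₂ n) (emb t ∷ vec X)

  vars-call : ∀ n t X → vars (call n t X) ≡ vars t ++ deduplicate _≟_ X
  vars-call n t X rewrite vars-emb t | varsL-map-var {F} (deduplicate _≟_ X) = refl

  ∈-vars-call : ∀ n t X {x} → x ∈ vars (call n t X) ⇔ x ∈ X ++ vars t
  ∈-vars-call n t X {x} = mk⇔ into outof
    where
    into : x ∈ vars (call n t X) → x ∈ X ++ vars t
    into x∈ with ∈-++⁻ (vars t) (subst (x ∈_) (vars-call n t X) x∈)
    ... | inj₁ x∈t = ∈-++⁺ʳ X x∈t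
    ... | inj₂ x∈X = ∈-++⁺ˡ (∈-deduplicate⁻ _≟_ X x∈X)
    outof : x ∈ X ++ vars t → x ∈ vars (call n t X)
    outof x∈ with ∈-++⁻ X x∈
    ... | inj₁ x∈X = subst (x ∈_) (sym (vars-call n t X)) (∈-++⁺ʳ (vars t) (∈-deduplicate⁺ _≟_ x∈X))
    ... | inj₂ x∈t = subst (x ∈_) (sym (vars-call n t X)) (∈-++⁺ˡ x∈t)

  -- Since X is listed without repetitions, the call is linear exactly when
  -- t is linear and shares no variable with X.
  Linear-call : ∀ n t X →
    Linear (call n t X) ⇔ (Linear t × (∀ x → x ∈ vars t → x ∉ X))
  Linear-call n t X = mk⇔ into outof
    where
    into : Linear (call n t X) → Linear t × (∀ x → x ∈ vars t → x ∉ X)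
    into lin with Unique-++⁻ (vars t) (subst Unique (vars-call n t X) lin)
    ... | lin-t , _ , t#X = lin-t , λ x x∈t x∈X → t#X (x∈t , ∈-deduplicate⁺ _≟_ x∈X)
    outof : Linear t × (∀ x → x ∈ vars t → x ∉ X) → Linear (call n t X)
    outof (lin-t , t#X) = subst Unique (sym (vars-call n t X))
      (++⁺ lin-t (deduplicate-! _≟_ X) λ (x∈t , x∈X) → t#X _ x∈t (∈-deduplicate⁻ _≟_ X x∈X))

  Linear-call-ground : ∀ n s X → vars s ⊆ X → Linear (call n s X) ⇔ Ground s
  Linear-call-ground n s X s⊆X = mk⇔ into outof
    where
    into : Linear (call n s X) → Ground s
    into lin = disjoint-subset⇒[] s⊆X λ (x∈s , x∈X) → proj₂ (to (Linear-call n s X) lin) _ x∈s x∈X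
    outof : Ground s → Linear (call n s X)
    outof ground = from (Linear-call n s X) (subst Unique (sym ground) [] , no-vars)
      where
      no-vars : ∀ x → x ∈ vars s → x ∉ X
      no-vars x x∈s with () ← subst (x ∈_) ground x∈s

module Unraveling {F V : Set} (_≟_ : DecidableEquality V) where
  open Unravel {F} {V} _≟_
  open Calls {F} {V} _≟_

  Conds : Set
  Conds = List (Term F V × Term F V)

  sAt tAt : (cs : Conds) → Fin (length cs) → Term F V
  sAt cs i = proj₁ (lookup cs i)
  tAt cs i = proj₂ (lookup cs i)

  FreshLinearTargets : List V → Conds → Set
  FreshLinearTargets X cs =
    ((i : Fin (length cs)) → Linear (tAt cs i))
    × ((i : Fin (length cs)) (x : V) → x ∈ vars (tAt cs i) → x ∉ before X cs (toℕ i))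

  LL-go : ∀ X n cur cs r →
    All LL (go X n cur cs r) ⇔ (Linear cur × FreshLinearTargets X cs)
  LL-go X n cur [] r = mk⇔ (λ { (lin ∷ []) → lin , (λ ()) , (λ ()) }) (λ (lin , _) → lin ∷ [])
  LL-go X n cur ((s , t) ∷ cs) r = mk⇔ into outof
    where
    IH = LL-go (X ++ vars t) (suc n) (call n t X) cs r
    into : All LL (go X n cur ((s , t) ∷ cs) r) → Linear cur × FreshLinearTargets X ((s , t) ∷ cs)
    into (lin-cur ∷ rest) with to IH rest
    ... | lin-call , lin-ts , fresh-ts with to (Linear-call n t X) lin-call
    ... | lin-t , fresh-t =
      lin-cur
      , ∀-cons lin-t lin-ts
      , ∀-cons (λ x x∈t → subst (x ∉_) (sym (before-zero X cs)) (fresh-t x x∈t))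
               (λ i x x∈t → subst (x ∉_) (before-suc X s t cs (toℕ i)) (fresh-ts i x x∈t))
    outof : Linear cur × FreshLinearTargets X ((s , t) ∷ cs) → All LL (go X n cur ((s , t) ∷ cs) r)
    outof (lin-cur , lin-ts , fresh-ts) = lin-cur ∷ from IH
      ( from (Linear-call n t X)
          (lin-ts zero , λ x x∈t → subst (x ∉_) (before-zero X cs) (fresh-ts zero x x∈t))
      , lin-ts ∘ suc
      , λ i x x∈t → subst (x ∉_) (sym (before-suc X s t cs (toℕ i))) (fresh-ts (suc i) x x∈t))

  DeterministicFrom : List V → Conds → Set
  DeterministicFrom X cs = (i : Fin (length cs)) → vars (sAt cs i) ⊆ before X cs (toℕ i)

  RL-go : ∀ X n cur cs r → DeterministicFrom X cs →
    All RL (go X n cur cs r) ⇔ (Linear r × ((i : Fin (length cs)) → Ground (sAt cs i)))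
  RL-go X n cur [] r det =
    mk⇔ (λ { (lin ∷ []) → to (Linear-emb r) lin , (λ ()) }) (λ (lin , _) → from (Linear-emb r) lin ∷ [])
  RL-go X n cur ((s , t) ∷ cs) r det = mk⇔
    (λ { (lin-call ∷ rest) → let lin-r , ground-ss = to IH rest in
       lin-r , ∀-cons (to first lin-call) ground-ss })
    (λ (lin-r , ground-ss) → from first (ground-ss zero) ∷ from IH (lin-r , ground-ss ∘ suc))
    where
    first = Linear-call-ground n s X (subst (vars s ⊆_) (before-zero X cs) (det zero))
    det-tail : DeterministicFrom (X ++ vars t) cs
    det-tail i = subst (vars (sAt cs i) ⊆_) (sym (before-suc X s t cs (toℕ i))) (det (suc i))
    IH = RL-go (X ++ vars t) (suc n) (call n t X) cs r det-tail

  HasVars : Term (F ⊎ ℕ) V → List V → Set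
  HasVars cur X = ∀ {x} → x ∈ vars cur ⇔ x ∈ X

  -- Only the last rule can lose variables: every intermediate right-hand side
  -- carries all of  X.
  NE-go : ∀ X n cur cs r → HasVars cur X →
    All NE (go X n cur cs r) ⇔ (X ++ condVars cs ⊆ vars r)
  NE-go X n cur [] r cur≈X = mk⇔
    (λ { (cur⊆r ∷ []) x∈ → subst (_ ∈_) (vars-emb r) (cur⊆r (from cur≈X (subst (_ ∈_) (++-identityʳ X) x∈))) })
    (λ X⊆r → (λ x∈ → subst (_ ∈_) (sym (vars-emb r)) (X⊆r (∈-++⁺ˡ (to cur≈X x∈)))) ∷ [])
  NE-go X n cur ((s , t) ∷ cs) r cur≈X = mk⇔
    (λ { (_ ∷ rest) x∈ → to IH rest (subst (_ ∈_) (sym reassoc) x∈) })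
    (λ X⊆r → first ∷ from IH (λ x∈ → X⊆r (subst (_ ∈_) reassoc x∈)))
    where
    reassoc = ++-assoc X (vars t) (condVars cs)
    first : NE (cur , call n s X)
    first x∈ = from (∈-vars-call n s X) (∈-++⁺ˡ (to cur≈X x∈))
    IH = NE-go (X ++ vars t) (suc n) (call n t X) cs r (∈-vars-call n t X)

theorem3p9 : {F V : Set} (_≟_ : DecidableEquality V) (ρ : CRule F V) →
    Deterministic ρ →
    let open Unravel {F} {V} _≟_ in
    (𝕌-LL ρ ⇔ (Linear (lhs ρ) × ((i : Fin (#conds ρ)) → Linear (tᵢ ρ i))
                × ((i : Fin (#conds ρ)) (x : V) → x ∈ vars (tᵢ ρ i) → x ∉ Xᵢ ρ i)))
    × (𝕌-RL ρ ⇔ (Linear (rhs ρ) × ((i : Fin (#conds ρ)) → Ground (sᵢ ρ i))))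
    × (𝕌-NE ρ ⇔ (allLT ρ ⊆ vars (rhs ρ)))
theorem3p9 {F} {V} _≟_ (l ⇒ r ⇐ cs) det =
  mk⇔ (λ u → let lin-l , targets = to LL-unraveled u in to (Linear-emb l) lin-l , targets)
      (λ (lin-l , targets) → from LL-unraveled (from (Linear-emb l) lin-l , targets))
  , RL-go (vars l) 1 (emb l) cs r det
  , mk⇔ (subst (_⊆ vars r) (sym all-conds) ∘ to NE-unraveled)
        (from NE-unraveled ∘ subst (_⊆ vars r) all-conds)
  where
  open Unravel {F} {V} _≟_
  open Unraveling {F} {V} _≟_
  LL-unraveled : 𝕌-LL (l ⇒ r ⇐ cs) ⇔ (Linear (emb l) × FreshLinearTargets (vars l) cs)
  LL-unraveled = LL-go (vars l) 1 (emb l) cs r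
  NE-unraveled : 𝕌-NE (l ⇒ r ⇐ cs) ⇔ (vars l ++ condVars cs ⊆ vars r)
  NE-unraveled = NE-go (vars l) 1 (emb l) cs r
    (mk⇔ (subst (_ ∈_) (vars-emb l)) (subst (_ ∈_) (sym (vars-emb l))))
  all-conds : before (vars l) cs (length cs) ≡ vars l ++ condVars cs
  all-conds = cong (λ cs′ → vars l ++ condVars cs′) (take-all (length cs) cs ≤-refl)
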